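{- For every integer $q\ge 2$, $\theta(\overline{ME_q})=\alpha(\overline{ME_q})$, and this common value equals $(3q+2)/2$ if $q$ is even and $(3q+3)/2$ if $q$ is odd.
   Context: For $q\ge 2$, $\overline{ME_q}$ is the graph with the $4q+2$ vertices $u_0,u_1,\dots,u_{q+1}$ and $v_{i1},v_{i2},v_{i3}$ ($i=1,\dots,q$), whose edges are: the edges of the Hamiltonian cycle $u_0,u_1,\dots,u_{q+1},v_{11},v_{12},v_{13},v_{21},v_{22},v_{23},\dots,v_{q1},v_{q2},v_{q3},u_0$; the edges $u_iv_{i2}$ for $i=1,\dots,q$; and the edges $v_{i1}v_{i3}$ for $i=1,\dots,q$. $\theta(H)$ is the clique partition number (minimum number of cliques partitioning $V(H)$) and $\alpha(H)$ the maximum size of an independent set. -}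

module Defs where

open import Data.Nat using (ℕ; zero; suc; _+_; _*_; _≤_; _<_; _%_)
open import Data.Fin using (Fin; toℕ)
open import Data.Fin.Subset using (Subset; _∈_; ∣_∣)
open import Data.Product using (Σ; ∃; _×_; _,_)
open import Data.Sum using (_⊎_)
open import Function.Definitions using (Surjective)
open import Relation.Binary.PropositionalEquality using (_≡_)
open import Relation.Nullary using (¬_)

-- Vertex labelling of  ME_q-bar  by position on the Hamiltonian cycle
--   u_0, u_1, ..., u_{q+1}, v_{11}, v_{12}, v_{13}, ..., v_{q1}, v_{q2}, v_{q3}
-- so  u_i  has index i  (0 ≤ i ≤ q+1)  and  v_{ij}  has index  q + 1 + 3(i-1) + j
-- (1 ≤ i ≤ q, 1 ≤ j ≤ 3).  Writing i = 1 + k (0 ≤ k < q):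
--   u_i = 1+k,  v_{i1} = q+3k+2,  v_{i2} = q+3k+3,  v_{i3} = q+3k+4.
-- Total number of vertices: 4q+2 (indices 0 .. 4q+1).

order : ℕ → ℕ
order q = 4 * q + 2

data Edge (q : ℕ) : ℕ → ℕ → Set where
  -- Hamiltonian cycle edges  a — a+1  for  a+1 < 4q+2
  cyc   : ∀ {a} → suc a < order q → Edge q a (suc a)
  -- closing cycle edge  v_{q3} — u_0
  close : Edge q (4 * q + 1) 0
  -- u_i — v_{i2}   (i = 1+k, 1 ≤ i ≤ q)
  spoke : ∀ {k} → suc k ≤ q → Edge q (suc k) (q + 3 * k + 3)
  -- v_{i1} — v_{i3}   (i = 1+k, 1 ≤ i ≤ q)
  chord : ∀ {k} → suc k ≤ q → Edge q (q + 3 * k + 2) (q + 3 * k + 4)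

Adj : (q : ℕ) → Fin (order q) → Fin (order q) → Set
Adj q x y = Edge q (toℕ x) (toℕ y) ⊎ Edge q (toℕ y) (toℕ x)

IsIndependent : (q : ℕ) → Subset (order q) → Set
IsIndependent q S = ∀ x y → x ∈ S → y ∈ S → ¬ Adj q x y

AlphaIs : ℕ → ℕ → Set
AlphaIs q m =
  (Σ (Subset (order q)) λ S → IsIndependent q S × ∣ S ∣ ≡ m)
  × (∀ (S : Subset (order q)) → IsIndependent q S → ∣ S ∣ ≤ m)

-- a partition of V into k (nonempty) cliques, given by the map
-- sending each vertex to the index of its part
IsCliquePartition : (q k : ℕ) → (Fin (order q) → Fin k) → Set
IsCliquePartition q k c =
  Surjective _≡_ _≡_ c
  × (∀ x y → c x ≡ c y → ¬ (x ≡ y) → Adj q x y)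

ThetaIs : ℕ → ℕ → Set
ThetaIs q m =
  (Σ (Fin (order q) → Fin m) λ c → IsCliquePartition q m c)
  × (∀ k (c : Fin (order q) → Fin k) → IsCliquePartition q k c → m ≤ k)

-- Take u_0, u_2, u_4, … together with one vertex of each triangle v_{i1} v_{i2} v_{i3}, and
-- cover the vertices by the cliques {u_{2j}, u_{2j+1}} (u_{q+1} alone when q is odd) and the q
-- triangles. Both have ⌈(q+2)/2⌉ + q members, and an independent set meets each clique of a
-- partition at most once, so α ≤ θ forces both to equal ⌈(q+2)/2⌉ + q.
module Submission where

open import Defs
open import Data.Bool using (Bool; true; false; not)
open import Data.Empty using (⊥; ⊥-elim)
open import Data.Fin using (Fin; zero; suc; toℕ; fromℕ<)
import Data.Fin.Properties as Finₚ
open import Data.Fin.Subset using (Subset; _∈_; ∣_∣; ⊤; _-_; inside; outside)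
open import Data.Fin.Subset.Properties using (∈⊤; ∣⊤∣≡n; x∈p∧x≢y⇒x∈p-y; x∈p⇒∣p-x∣<∣p∣)
open import Data.Nat using (ℕ; zero; suc; _+_; _*_; _≤_; _<_; _%_; ⌊_/2⌋; ⌈_/2⌉; z≤n; s≤s; z<s; s<s)
open import Data.Nat.DivMod using (_divMod_; result)
open import Data.Nat.Properties
  using ( ≤-reflexive; ≤-trans; <⇒≤; ≤-pred; ≤-<-trans; <-≤-trans; <⇒≢; m≤n⇒m<n∨m≡n; m≤m+n
        ; +-identityʳ; +-suc; +-assoc; +-comm; *-comm; *-suc; +-cancelˡ-≡; +-cancelˡ-<
        ; +-monoʳ-<; +-monoʳ-≤; *-monoʳ-≤; *-cancelˡ-<; ⌊n/2⌋-mono; ⌊n/2⌋+⌈n/2⌉≡n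
        ; ⌊n/2⌋≤⌈n/2⌉; n≡⌊n+n/2⌋; +-mono-≤; +-monoˡ-<; *-distribˡ-+; m≤n⇒m≤1+n; module ≤-Reasoning)
  renaming (suc-injective to ℕ-suc-injective)
open import Data.Nat.Tactic.RingSolver using (solve-∀)
open import Data.Product using (Σ; _×_; _,_)
open import Data.Sum using (_⊎_; inj₁; inj₂) renaming (map to ⊎-map; swap to ⊎-swap)
open import Data.Vec using (_∷_; []; tabulate; here; there)
open import Data.Vec.Properties using ([]=⇒lookup; lookup∘tabulate)
open import Function using (_∘_)
open import Function.Definitions using (Surjective)
open import Relation.Binary.PropositionalEquality
open import Relation.Nullary using (yes; no)

∣p∣≤∣q∣-injectiveOn : ∀ {n k} (p : Subset n) {q : Subset k} (f : Fin n → Fin k) →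
  (∀ {x} → x ∈ p → f x ∈ q) →
  (∀ {x y} → x ∈ p → y ∈ p → f x ≡ f y → x ≡ y) →
  ∣ p ∣ ≤ ∣ q ∣
∣p∣≤∣q∣-injectiveOn []            f into injective = z≤n
∣p∣≤∣q∣-injectiveOn (outside ∷ p) f into injective =
  ∣p∣≤∣q∣-injectiveOn p (f ∘ suc) (into ∘ there)
    (λ x∈p y∈p → Finₚ.suc-injective ∘ injective (there x∈p) (there y∈p))
∣p∣≤∣q∣-injectiveOn (inside ∷ p) {q} f into injective =
  ≤-<-trans (∣p∣≤∣q∣-injectiveOn p (f ∘ suc) into′
              (λ x∈p y∈p → Finₚ.suc-injective ∘ injective (there x∈p) (there y∈p)))
            (x∈p⇒∣p-x∣<∣p∣ (into here))
  where
  into′ : ∀ {x} → x ∈ p → f (suc x) ∈ q - f zero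
  into′ x∈p = x∈p∧x≢y⇒x∈p-y (into (there x∈p))
    (λ f[1+x]≡f0 → Finₚ.0≢1+n (injective here (there x∈p) (sym f[1+x]≡f0)))

independent≤parts : ∀ {q k} {S : Subset (order q)} {c : Fin (order q) → Fin k} →
  IsIndependent q S → IsCliquePartition q k c → ∣ S ∣ ≤ k
independent≤parts {q} {k} {S} {c} independent (_ , sameClass⇒adjacent) =
  subst (∣ S ∣ ≤_) (∣⊤∣≡n k) (∣p∣≤∣q∣-injectiveOn S c (λ _ → ∈⊤) injectiveOnS)
  where
  injectiveOnS : ∀ {x y} → x ∈ S → y ∈ S → c x ≡ c y → x ≡ y
  injectiveOnS {x} {y} x∈S y∈S cx≡cy with x Finₚ.≟ y
  ... | yes x≡y = x≡y
  ... | no  x≢y = ⊥-elim (independent x y x∈S y∈S (sameClass⇒adjacent x y cx≡cy x≢y))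

equalWitnesses⇒ThetaIs×AlphaIs : ∀ {q m} {S : Subset (order q)} {c : Fin (order q) → Fin m} →
  IsIndependent q S → ∣ S ∣ ≡ m → IsCliquePartition q m c → ThetaIs q m × AlphaIs q m
equalWitnesses⇒ThetaIs×AlphaIs {S = S} {c} independent ∣S∣≡m partition =
  ((c , partition) , λ k _ partition′ → subst (_≤ k) ∣S∣≡m (independent≤parts independent partition′))
  , ((S , independent , ∣S∣≡m) , λ _ independent′ → independent≤parts independent′ partition)

data Region (c : ℕ) : ℕ → Set where
  below : ∀ {n} → n < c → Region c n
  above : ∀ m → Region c (c + m)

region : ∀ c n → Region c n
region zero    n       = above n
region (suc c) zero    = below z<s
region (suc c) (suc n) with region c n
... | below n<c = below (s<s n<c)
... | above m   = above m

splice : ∀ {A : Set} → ℕ → (ℕ → A) → (ℕ → A) → ℕ → A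
splice zero    e g n       = g n
splice (suc c) e g zero    = e zero
splice (suc c) e g (suc n) = splice c (e ∘ suc) g n

splice-< : ∀ {A : Set} c (e g : ℕ → A) {n} → n < c → splice c e g n ≡ e n
splice-< (suc c) e g {zero}  _         = refl
splice-< (suc c) e g {suc n} (s<s n<c) = splice-< c (e ∘ suc) g n<c

splice-+ : ∀ {A : Set} c (e g : ℕ → A) m → splice c e g (c + m) ≡ g m
splice-+ zero    e g m = refl
splice-+ (suc c) e g m = splice-+ c (e ∘ suc) g m

blocks : ∀ {A : Set} → (ℕ → Fin 3 → A) → ℕ → A
blocks g 0                         = g 0 zero
blocks g 1                         = g 0 (suc zero)
blocks g 2                         = g 0 (suc (suc zero))
blocks g (suc (suc (suc j)))       = blocks (g ∘ suc) j

blocks-3k+r : ∀ {A : Set} (g : ℕ → Fin 3 → A) k r → blocks g (3 * k + toℕ r) ≡ g k r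
blocks-3k+r g zero    zero             = refl
blocks-3k+r g zero    (suc zero)       = refl
blocks-3k+r g zero    (suc (suc zero)) = refl
blocks-3k+r g (suc k) r = begin
  blocks g (3 * suc k + toℕ r)    ≡⟨ cong (λ j → blocks g (j + toℕ r)) (*-suc 3 k) ⟩
  blocks g (3 + 3 * k + toℕ r)    ≡⟨ cong (blocks g) (+-assoc 3 (3 * k) (toℕ r)) ⟩
  blocks (g ∘ suc) (3 * k + toℕ r) ≡⟨ blocks-3k+r (g ∘ suc) k r ⟩
  g (suc k) r                     ∎
  where open ≡-Reasoning

indicator : Bool → ℕ
indicator true  = 1
indicator false = 0

count : (ℕ → Bool) → ℕ → ℕ
count h zero    = 0
count h (suc n) = indicator (h 0) + count (h ∘ suc) n

∣tabulate∣≡count : ∀ n (h : ℕ → Bool) → ∣ tabulate {n = n} (h ∘ toℕ) ∣ ≡ count h n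
∣tabulate∣≡count zero    h = refl
∣tabulate∣≡count (suc n) h with h 0
... | true  = cong suc (∣tabulate∣≡count n (h ∘ suc))
... | false = ∣tabulate∣≡count n (h ∘ suc)

count-+ : ∀ a b h → count h (a + b) ≡ count h a + count (λ i → h (a + i)) b
count-+ zero    b h = refl
count-+ (suc a) b h =
  trans (cong (indicator (h 0) +_) (count-+ a b (h ∘ suc))) (sym (+-assoc (indicator (h 0)) _ _))

count-splice : ∀ c m (e g : ℕ → Bool) → count (splice c e g) (c + m) ≡ count e c + count g m
count-splice zero    m e g = refl
count-splice (suc c) m e g =
  trans (cong (indicator (e 0) +_) (count-splice c m (e ∘ suc) g)) (sym (+-assoc (indicator (e 0)) _ _))

count-blocks : ∀ (g : ℕ → Fin 3 → Bool) → (∀ k → count (blocks (λ _ → g k)) 3 ≡ 1) →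
  ∀ k → count (blocks g) (3 * k) ≡ k
count-blocks g one zero    = refl
count-blocks g one (suc k) = begin
  count (blocks g) (3 * suc k)                                    ≡⟨ cong (count (blocks g)) (*-suc 3 k) ⟩
  count (blocks g) (3 + 3 * k)                                    ≡⟨ count-+ 3 (3 * k) (blocks g) ⟩
  count (blocks (λ _ → g 0)) 3 + count (blocks (g ∘ suc)) (3 * k)
    ≡⟨ cong₂ _+_ (one 0) (count-blocks (g ∘ suc) (one ∘ suc) k) ⟩
  suc k                                                           ∎
  where open ≡-Reasoning

evenᵇ : ℕ → Bool
evenᵇ 0             = true
evenᵇ 1             = false
evenᵇ (suc (suc n)) = evenᵇ n

evenᵇ-consecutive : ∀ n → evenᵇ n ≡ false ⊎ evenᵇ (suc n) ≡ false
evenᵇ-consecutive 0             = inj₂ refl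
evenᵇ-consecutive 1             = inj₁ refl
evenᵇ-consecutive (suc (suc n)) = evenᵇ-consecutive n

count-evenᵇ : ∀ n → count evenᵇ n ≡ ⌈ n /2⌉
count-evenᵇ 0             = refl
count-evenᵇ 1             = refl
count-evenᵇ (suc (suc n)) = cong suc (count-evenᵇ n)

⌊m/2⌋≡⌊n/2⌋⇒1+m≡n⊎1+n≡m : ∀ {m n} → ⌊ m /2⌋ ≡ ⌊ n /2⌋ → m ≢ n → suc m ≡ n ⊎ suc n ≡ m
⌊m/2⌋≡⌊n/2⌋⇒1+m≡n⊎1+n≡m {0}             {0}             _ m≢n = ⊥-elim (m≢n refl)
⌊m/2⌋≡⌊n/2⌋⇒1+m≡n⊎1+n≡m {0}             {1}             _ _   = inj₁ refl
⌊m/2⌋≡⌊n/2⌋⇒1+m≡n⊎1+n≡m {1}             {0}             _ _   = inj₂ refl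
⌊m/2⌋≡⌊n/2⌋⇒1+m≡n⊎1+n≡m {1}             {1}             _ m≢n = ⊥-elim (m≢n refl)
⌊m/2⌋≡⌊n/2⌋⇒1+m≡n⊎1+n≡m {suc (suc m)}   {suc (suc n)}   eq m≢n =
  ⊎-map (cong (2 +_)) (cong (2 +_))
    (⌊m/2⌋≡⌊n/2⌋⇒1+m≡n⊎1+n≡m (ℕ-suc-injective eq) (m≢n ∘ cong (2 +_)))

⌊n/2⌋+⌊n/2⌋≤n : ∀ n → ⌊ n /2⌋ + ⌊ n /2⌋ ≤ n
⌊n/2⌋+⌊n/2⌋≤n n = ≤-trans (+-monoʳ-≤ ⌊ n /2⌋ (⌊n/2⌋≤⌈n/2⌉ n)) (≤-reflexive (⌊n/2⌋+⌈n/2⌉≡n n))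

2*⌈n/2⌉≡n+n%2 : ∀ n → 2 * ⌈ n /2⌉ ≡ n + n % 2
2*⌈n/2⌉≡n+n%2 0             = refl
2*⌈n/2⌉≡n+n%2 1             = refl
2*⌈n/2⌉≡n+n%2 (suc (suc n)) = trans (*-suc 2 ⌈ n /2⌉) (cong (2 +_) (2*⌈n/2⌉≡n+n%2 n))

pattern v₁ = zero
pattern v₂ = suc zero
pattern v₃ = suc (suc zero)

-- vIndex q k vⱼ is the index of v_{k+1,j} in the labelling of Defs.
vIndex : ℕ → ℕ → Fin 3 → ℕ
vIndex q k r = q + 3 * k + (2 + toℕ r)

suc-v₁≡v₂ : ∀ q k → suc (vIndex q k v₁) ≡ vIndex q k v₂
suc-v₁≡v₂ q k = sym (+-suc (q + 3 * k) 2)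

suc-v₂≡v₃ : ∀ q k → suc (vIndex q k v₂) ≡ vIndex q k v₃
suc-v₂≡v₃ q k = sym (+-suc (q + 3 * k) 3)

vIndex≡ : ∀ q k r → vIndex q k r ≡ (2 + q) + (3 * k + toℕ r)
vIndex≡ q k r = shift q k (toℕ r)
  where
  shift : ∀ q k r → q + 3 * k + (2 + r) ≡ (2 + q) + (3 * k + r)
  shift = solve-∀

order≡ : ∀ q → 4 * q + 2 ≡ (2 + q) + 3 * q
order≡ = solve-∀

2+q≤order : ∀ q → 2 + q ≤ order q
2+q≤order q = subst (2 + q ≤_) (sym (order≡ q)) (m≤m+n (2 + q) (3 * q))

3k+r<3q : ∀ {k q} (r : Fin 3) → k < q → 3 * k + toℕ r < 3 * q
3k+r<3q {k} {q} r k<q = begin-strict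
  3 * k + toℕ r ≡⟨ +-comm (3 * k) (toℕ r) ⟩
  toℕ r + 3 * k <⟨ +-monoˡ-< (3 * k) (Finₚ.toℕ<n r) ⟩
  3 + 3 * k     ≡⟨ *-suc 3 k ⟨
  3 * suc k     ≤⟨ *-monoʳ-≤ 3 k<q ⟩
  3 * q         ∎
  where open ≤-Reasoning

vIndex<order : ∀ {q k} (r : Fin 3) → k < q → vIndex q k r < order q
vIndex<order {q} {k} r k<q =
  subst₂ _<_ (sym (vIndex≡ q k r)) (sym (order≡ q)) (+-monoʳ-< (2 + q) (3k+r<3q r k<q))

data Vertex (q : ℕ) : ℕ → Set where
  u : ∀ {i} → i < 2 + q → Vertex q i
  v : ∀ {k} → k < q → (r : Fin 3) → Vertex q (vIndex q k r)

vertexAt : ∀ q j → (2 + q) + j < order q → Vertex q ((2 + q) + j)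
vertexAt q j n<order with j divMod 3
... | result k r j≡r+k*3 = subst (Vertex q) vIndex≡n (v k<q r)
  where
  j≡3k+r : j ≡ 3 * k + toℕ r
  j≡3k+r = trans j≡r+k*3 (trans (+-comm (toℕ r) (k * 3)) (cong (_+ toℕ r) (*-comm k 3)))
  offset<3q : 3 * k + toℕ r < 3 * q
  offset<3q = subst (_< 3 * q) j≡3k+r
    (+-cancelˡ-< (2 + q) j (3 * q) (subst ((2 + q) + j <_) (order≡ q) n<order))
  k<q : k < q
  k<q = *-cancelˡ-< 3 k q (≤-<-trans (m≤m+n (3 * k) (toℕ r)) offset<3q)
  vIndex≡n : vIndex q k r ≡ (2 + q) + j
  vIndex≡n = trans (vIndex≡ q k r) (cong ((2 + q) +_) (sym j≡3k+r))

vertex : ∀ q {n} → n < order q → Vertex q n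
vertex q {n} n<order with region (2 + q) n
... | below n<2+q = u n<2+q
... | above j     = vertexAt q j n<order

onVertices : ∀ {A : Set} → ℕ → (ℕ → A) → (ℕ → Fin 3 → A) → ℕ → A
onVertices q onU onV = splice (2 + q) onU (blocks onV)

module _ {A : Set} (q : ℕ) (onU : ℕ → A) (onV : ℕ → Fin 3 → A) where

  onVertices-u : ∀ {i} → i < 2 + q → onVertices q onU onV i ≡ onU i
  onVertices-u = splice-< (2 + q) onU (blocks onV)

  onVertices-v : ∀ k r → onVertices q onU onV (vIndex q k r) ≡ onV k r
  onVertices-v k r = begin
    onVertices q onU onV (vIndex q k r)                       ≡⟨ cong (onVertices q onU onV) (vIndex≡ q k r) ⟩
    splice (2 + q) onU (blocks onV) (2 + q + (3 * k + toℕ r))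
      ≡⟨ splice-+ (2 + q) onU (blocks onV) (3 * k + toℕ r) ⟩
    blocks onV (3 * k + toℕ r)                                ≡⟨ blocks-3k+r onV k r ⟩
    onV k r                                                   ∎
    where open ≡-Reasoning

count-onVertices : ∀ q (onU : ℕ → Bool) onV →
  count (onVertices q onU onV) (order q) ≡ count onU (2 + q) + count (blocks onV) (3 * q)
count-onVertices q onU onV =
  trans (cong (count (onVertices q onU onV)) (order≡ q)) (count-splice (2 + q) (3 * q) onU (blocks onV))

optimum : ℕ → ℕ
optimum q = ⌈ 2 + q /2⌉ + q

2*optimum : ∀ q → 2 * optimum q ≡ 3 * q + 2 + q % 2
2*optimum q = begin
  2 * (⌈ 2 + q /2⌉ + q)         ≡⟨ *-distribˡ-+ 2 ⌈ 2 + q /2⌉ q ⟩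
  2 * ⌈ 2 + q /2⌉ + 2 * q       ≡⟨ cong (_+ 2 * q) (2*⌈n/2⌉≡n+n%2 (2 + q)) ⟩
  2 + q + q % 2 + 2 * q         ≡⟨ rearrange q (q % 2) ⟩
  3 * q + 2 + q % 2             ∎
  where
  open ≡-Reasoning
  rearrange : ∀ q p → 2 + q + p + 2 * q ≡ 3 * q + 2 + p
  rearrange = solve-∀

-- Triangle i = k + 1 contributes v_{i2} for odd i and v_{i1} for even i: v_{i2} is adjacent to
-- u_i, v_{11} to u_{q+1} and v_{q3} to u_0.
triangleChoice : ℕ → Fin 3 → Bool
triangleChoice k v₁ = not (evenᵇ k)
triangleChoice k v₂ = evenᵇ k
triangleChoice k v₃ = false

inIndependentSet : ℕ → ℕ → Bool
inIndependentSet q = onVertices q evenᵇ triangleChoice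

inIndependentSet-u : ∀ q {i} → i < 2 + q → inIndependentSet q i ≡ evenᵇ i
inIndependentSet-u q = onVertices-u q evenᵇ triangleChoice

inIndependentSet-v : ∀ q k r → inIndependentSet q (vIndex q k r) ≡ triangleChoice k r
inIndependentSet-v q = onVertices-v q evenᵇ triangleChoice

not-b≡false⊎b≡false : ∀ b → not b ≡ false ⊎ b ≡ false
not-b≡false⊎b≡false true  = inj₁ refl
not-b≡false⊎b≡false false = inj₂ refl

edge⇒notBothIn : ∀ q {a b} → Edge q a b →
  inIndependentSet q a ≡ false ⊎ inIndependentSet q b ≡ false
edge⇒notBothIn q {a} (cyc 1+a<order) with vertex q (<⇒≤ 1+a<order)
... | u a<2+q with m≤n⇒m<n∨m≡n a<2+q
...   | inj₁ 1+a<2+q =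
  ⊎-map (trans (inIndependentSet-u q a<2+q)) (trans (inIndependentSet-u q 1+a<2+q)) (evenᵇ-consecutive a)
...   | inj₂ 1+a≡2+q =
  inj₂ (trans (cong (inIndependentSet q) (trans 1+a≡2+q (sym (firstV q)))) (inIndependentSet-v q 0 v₁))
  where
  firstV : ∀ q → q + 3 * 0 + 2 ≡ 2 + q
  firstV = solve-∀
edge⇒notBothIn q (cyc _) | v {k} _ v₁ =
  ⊎-map (trans (inIndependentSet-v q k v₁))
        (trans (cong (inIndependentSet q) (suc-v₁≡v₂ q k)) ∘ trans (inIndependentSet-v q k v₂))
        (not-b≡false⊎b≡false (evenᵇ k))
edge⇒notBothIn q (cyc _) | v {k} _ v₂ =
  inj₂ (trans (cong (inIndependentSet q) (suc-v₂≡v₃ q k)) (inIndependentSet-v q k v₃))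
edge⇒notBothIn q (cyc _) | v {k} _ v₃ = inj₁ (inIndependentSet-v q k v₃)
edge⇒notBothIn zero    close = inj₁ refl
edge⇒notBothIn (suc q) close =
  inj₁ (trans (cong (inIndependentSet (suc q)) (lastV q)) (inIndependentSet-v (suc q) q v₃))
  where
  lastV : ∀ q → 4 * suc q + 1 ≡ suc q + 3 * q + 4
  lastV = solve-∀
edge⇒notBothIn q (spoke {k} 1+k≤q) =
  ⊎-swap (⊎-map (trans (inIndependentSet-v q k v₂))
                (trans (inIndependentSet-u q (s<s (m≤n⇒m≤1+n 1+k≤q))))
                (evenᵇ-consecutive k))
edge⇒notBothIn q (chord {k} _) = inj₂ (inIndependentSet-v q k v₃)

independentSet : ∀ q → Subset (order q)
independentSet q = tabulate (inIndependentSet q ∘ toℕ)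

∈independentSet⇒true : ∀ q {x} → x ∈ independentSet q → inIndependentSet q (toℕ x) ≡ true
∈independentSet⇒true q {x} x∈S =
  trans (sym (lookup∘tabulate (inIndependentSet q ∘ toℕ) x)) ([]=⇒lookup x∈S)

independentSet-isIndependent : ∀ q → IsIndependent q (independentSet q)
independentSet-isIndependent q x y x∈S y∈S (inj₁ edge) =
  notBoth (edge⇒notBothIn q edge) (∈independentSet⇒true q x∈S) (∈independentSet⇒true q y∈S)
  where
  notBoth : ∀ {a b : Bool} → a ≡ false ⊎ b ≡ false → a ≡ true → b ≡ true → ⊥
  notBoth (inj₁ refl) () _
  notBoth (inj₂ refl) _ ()
independentSet-isIndependent q x y x∈S y∈S (inj₂ edge) =
  independentSet-isIndependent q y x y∈S x∈S (inj₁ edge)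

∣independentSet∣ : ∀ q → ∣ independentSet q ∣ ≡ optimum q
∣independentSet∣ q = begin
  ∣ independentSet q ∣                                        ≡⟨ ∣tabulate∣≡count (order q) (inIndependentSet q) ⟩
  count (inIndependentSet q) (order q)                        ≡⟨ count-onVertices q evenᵇ triangleChoice ⟩
  count evenᵇ (2 + q) + count (blocks triangleChoice) (3 * q)
    ≡⟨ cong₂ _+_ (count-evenᵇ (2 + q)) (count-blocks triangleChoice oneChoice q) ⟩
  optimum q                                                   ∎
  where
  open ≡-Reasoning
  oneChoice : ∀ k → count (blocks (λ _ → triangleChoice k)) 3 ≡ 1
  oneChoice k with evenᵇ k
  ... | true  = refl
  ... | false = refl

cliqueOf : ℕ → ℕ → ℕ
cliqueOf q = onVertices q ⌊_/2⌋ (λ k _ → ⌈ 2 + q /2⌉ + k)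

cliqueOf-u : ∀ q {i} → i < 2 + q → cliqueOf q i ≡ ⌊ i /2⌋
cliqueOf-u q = onVertices-u q ⌊_/2⌋ (λ k _ → ⌈ 2 + q /2⌉ + k)

cliqueOf-v : ∀ q k r → cliqueOf q (vIndex q k r) ≡ ⌈ 2 + q /2⌉ + k
cliqueOf-v q = onVertices-v q ⌊_/2⌋ (λ k _ → ⌈ 2 + q /2⌉ + k)

⌊i/2⌋<⌈2+q/2⌉ : ∀ {i q} → i < 2 + q → ⌊ i /2⌋ < ⌈ 2 + q /2⌉
⌊i/2⌋<⌈2+q/2⌉ i<2+q = s≤s (⌊n/2⌋-mono (≤-pred i<2+q))

cliqueOf-u<cliqueOf-v : ∀ q {i k} r → i < 2 + q → cliqueOf q i < cliqueOf q (vIndex q k r)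
cliqueOf-u<cliqueOf-v q {i} {k} r i<2+q =
  subst₂ _<_ (sym (cliqueOf-u q i<2+q)) (sym (cliqueOf-v q k r))
    (<-≤-trans (⌊i/2⌋<⌈2+q/2⌉ i<2+q) (m≤m+n ⌈ 2 + q /2⌉ k))

cliqueOf<optimum : ∀ q {n} → n < order q → cliqueOf q n < optimum q
cliqueOf<optimum q n<order with vertex q n<order
... | u i<2+q =
  subst (_< optimum q) (sym (cliqueOf-u q i<2+q)) (<-≤-trans (⌊i/2⌋<⌈2+q/2⌉ i<2+q) (m≤m+n ⌈ 2 + q /2⌉ q))
... | v {k} k<q r = subst (_< optimum q) (sym (cliqueOf-v q k r)) (+-monoʳ-< ⌈ 2 + q /2⌉ k<q)

cycle : ∀ {q a b} → b < order q → suc a ≡ b → Edge q a b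
cycle b<order refl = cyc b<order

triangle-adjacent : ∀ {q k} → k < q → ∀ {r r′} → r ≢ r′ →
  Edge q (vIndex q k r) (vIndex q k r′) ⊎ Edge q (vIndex q k r′) (vIndex q k r)
triangle-adjacent {q} {k} k<q {r} {r′} r≢r′ = triangle r r′ r≢r′
  where
  v₁v₂ : Edge q (vIndex q k v₁) (vIndex q k v₂)
  v₁v₂ = cycle (vIndex<order v₂ k<q) (suc-v₁≡v₂ q k)
  v₂v₃ : Edge q (vIndex q k v₂) (vIndex q k v₃)
  v₂v₃ = cycle (vIndex<order v₃ k<q) (suc-v₂≡v₃ q k)
  triangle : ∀ r r′ → r ≢ r′ →
    Edge q (vIndex q k r) (vIndex q k r′) ⊎ Edge q (vIndex q k r′) (vIndex q k r)
  triangle v₁ v₂ _   = inj₁ v₁v₂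
  triangle v₂ v₁ _   = inj₂ v₁v₂
  triangle v₂ v₃ _   = inj₁ v₂v₃
  triangle v₃ v₂ _   = inj₂ v₂v₃
  triangle v₁ v₃ _   = inj₁ (chord k<q)
  triangle v₃ v₁ _   = inj₂ (chord k<q)
  triangle v₁ v₁ r≢r = ⊥-elim (r≢r refl)
  triangle v₂ v₂ r≢r = ⊥-elim (r≢r refl)
  triangle v₃ v₃ r≢r = ⊥-elim (r≢r refl)

sameClique⇒adjacent : ∀ q {a b} → Vertex q a → Vertex q b → cliqueOf q a ≡ cliqueOf q b → a ≢ b →
  Edge q a b ⊎ Edge q b a
sameClique⇒adjacent q (u a<2+q) (u b<2+q) same a≢b =
  ⊎-map (cycle (<-≤-trans b<2+q (2+q≤order q))) (cycle (<-≤-trans a<2+q (2+q≤order q)))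
    (⌊m/2⌋≡⌊n/2⌋⇒1+m≡n⊎1+n≡m (trans (sym (cliqueOf-u q a<2+q)) (trans same (cliqueOf-u q b<2+q))) a≢b)
sameClique⇒adjacent q (u a<2+q) (v {k} _ r) same _ =
  ⊥-elim (<⇒≢ (cliqueOf-u<cliqueOf-v q {k = k} r a<2+q) same)
sameClique⇒adjacent q (v {k} _ r) (u b<2+q) same _ =
  ⊥-elim (<⇒≢ (cliqueOf-u<cliqueOf-v q {k = k} r b<2+q) (sym same))
sameClique⇒adjacent q (v {k} k<q r) (v {k′} _ r′) same a≢b
  with +-cancelˡ-≡ ⌈ 2 + q /2⌉ k k′ (trans (sym (cliqueOf-v q k r)) (trans same (cliqueOf-v q k′ r′)))
... | refl = triangle-adjacent k<q (a≢b ∘ cong (vIndex q k))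

cliqueRepresentative : ∀ q {t} → t < optimum q → Σ ℕ λ n → n < order q × cliqueOf q n ≡ t
cliqueRepresentative q {t} t<optimum with region ⌈ 2 + q /2⌉ t
... | below t<⌈2+q/2⌉ =
  t + t , <-≤-trans t+t<2+q (2+q≤order q) , trans (cliqueOf-u q t+t<2+q) (sym (n≡⌊n+n/2⌋ t))
  where
  t≤⌊1+q/2⌋ : t ≤ ⌊ 1 + q /2⌋
  t≤⌊1+q/2⌋ = ≤-pred t<⌈2+q/2⌉
  t+t<2+q : t + t < 2 + q
  t+t<2+q = s≤s (≤-trans (+-mono-≤ t≤⌊1+q/2⌋ t≤⌊1+q/2⌋) (⌊n/2⌋+⌊n/2⌋≤n (1 + q)))
... | above k =
  vIndex q k v₁ , vIndex<order v₁ k<q , cliqueOf-v q k v₁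
  where
  k<q : k < q
  k<q = +-cancelˡ-< ⌈ 2 + q /2⌉ k q t<optimum

cliquePartition : ∀ q → Fin (order q) → Fin (optimum q)
cliquePartition q x = fromℕ< (cliqueOf<optimum q (Finₚ.toℕ<n x))

toℕ-cliquePartition : ∀ q x → toℕ (cliquePartition q x) ≡ cliqueOf q (toℕ x)
toℕ-cliquePartition q x = Finₚ.toℕ-fromℕ< (cliqueOf<optimum q (Finₚ.toℕ<n x))

cliquePartition-isCliquePartition : ∀ q → IsCliquePartition q (optimum q) (cliquePartition q)
cliquePartition-isCliquePartition q = surjective , sameClique⇒adjacent′
  where
  surjective : Surjective _≡_ _≡_ (cliquePartition q)
  surjective y with cliqueRepresentative q (Finₚ.toℕ<n y)
  ... | n , n<order , cliqueOf-n≡y = fromℕ< n<order , λ { refl → Finₚ.toℕ-injective (begin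
    toℕ (cliquePartition q (fromℕ< n<order)) ≡⟨ toℕ-cliquePartition q (fromℕ< n<order) ⟩
    cliqueOf q (toℕ (fromℕ< n<order))        ≡⟨ cong (cliqueOf q) (Finₚ.toℕ-fromℕ< n<order) ⟩
    cliqueOf q n                             ≡⟨ cliqueOf-n≡y ⟩
    toℕ y                                    ∎) }
    where open ≡-Reasoning
  sameClique⇒adjacent′ : ∀ x y → cliquePartition q x ≡ cliquePartition q y → x ≢ y → Adj q x y
  sameClique⇒adjacent′ x y same x≢y =
    sameClique⇒adjacent q (vertex q (Finₚ.toℕ<n x)) (vertex q (Finₚ.toℕ<n y))
      (trans (sym (toℕ-cliquePartition q x)) (trans (cong toℕ same) (toℕ-cliquePartition q y)))
      (x≢y ∘ Finₚ.toℕ-injective)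

theorem4 : (q : ℕ) → 2 ≤ q →
    Σ ℕ λ m → ThetaIs q m × AlphaIs q m
      × (q % 2 ≡ 0 → 2 * m ≡ 3 * q + 2)
      × (q % 2 ≡ 1 → 2 * m ≡ 3 * q + 3)
-- The construction works for every q.
theorem4 q _ =
  let θ , α = equalWitnesses⇒ThetaIs×AlphaIs
                (independentSet-isIndependent q) (∣independentSet∣ q) (cliquePartition-isCliquePartition q)
  in optimum q , θ , α
     , (λ q%2≡0 → trans (2*optimum q) (trans (cong (3 * q + 2 +_) q%2≡0) (+-identityʳ (3 * q + 2))))
     , (λ q%2≡1 → trans (2*optimum q) (trans (cong (3 * q + 2 +_) q%2≡1) (+-assoc (3 * q) 2 1)))
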